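{- For every integer $k\ge3$ and every $w$, $$\lim_{j\to\infty}\frac{\#\{m\in\{1,\dots,j\}:\ n_{k-2}(m)<w\}}{j}=0,$$ where $n_{k-2}(m)$ is the third term of the canonical $k$-representation of $m$, and $m$ whose canonical representation has fewer than three terms are counted as satisfying $n_{k-2}(m)<w$.
   Context: $\binom{n}{l}=0$ if $l>n$ or $l<0$. The canonical $k$-representation of a positive integer $m$ is the unique expression $m=\sum_{i=0}^s\binom{n_{k-i}}{k-i}$ with $s\ge0$ and $n_k>n_{k-1}>\dots>n_{k-s}\ge k-s>0$. -}

module Defs where

open import Data.Nat using (ℕ; zero; suc; _+_; _∸_; _≤_; _<_; _>_)
open import Data.Nat.Combinatorics using (_C_)
open import Data.Integer using (ℤ; +_) renaming (_<_ to _<ℤ_)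
open import Data.List using (List; []; _∷_; length)
open import Data.List.Relation.Unary.All using (All)
open import Data.List.Relation.Unary.Unique.Propositional using (Unique)
open import Data.List.Relation.Unary.Linked using (Linked)
open import Data.Unit using (⊤)
open import Relation.Binary.PropositionalEquality using (_≡_)
open import Data.Product using (_×_; ∃)

repSum : ℕ → List ℕ → ℕ
repSum l []       = 0
repSum l (n ∷ ns) = n C l + repSum (l ∸ 1) ns

Bounds : ℕ → List ℕ → Set
Bounds l []       = ⊤
Bounds l (n ∷ ns) = l ≤ n × 0 < l × Bounds (l ∸ 1) ns

-- The list ns = [n_k, n_{k-1}, …, n_{k-s}] is the canonical
-- k-representation of m:  m = Σ_{i=0}^{s} (n_{k-i} C (k-i)),
-- s ≥ 0 (nonempty list), n_k > n_{k-1} > … > n_{k-s} ≥ k-s > 0.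
IsCanonRep : ℕ → ℕ → List ℕ → Set
IsCanonRep k m ns =
  0 < length ns × Linked _>_ ns × Bounds k ns × repSum k ns ≡ m

-- "n_{k-2} < w", where representations with fewer than three terms count
-- as satisfying it.
ThirdBelow : ℤ → List ℕ → Set
ThirdBelow w (a ∷ b ∷ c ∷ _) = + c <ℤ w
ThirdBelow w _               = ⊤

SmallThird : ℕ → ℤ → ℕ → Set
SmallThird k w m = ∃ λ ns → IsCanonRep k m ns × ThirdBelow w ns

DistinctIn : (ℕ → Set) → ℕ → List ℕ → Set
DistinctIn P j L = Unique L × All (λ m → 1 ≤ m × m ≤ j × P m) L

-- Write k = 3 + i and W = ∣w∣.  If m ≤ j has a small third term, then
--   m = a C k + (b C (k-1) + r)   with  b ≤ a ≤ N  and  r ≤ W C (k-2),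
-- where N is the largest a with a C k ≤ j: the remainder r is the tail of the
-- representation from its third term on, and a canonical tail starting with
-- c is smaller than (c+1) C (k-2) ≤ W C (k-2).  Hence such m lie in a list of
-- (N+1)·(N+1)·B candidate values, B = W C (k-2) + 1, and by the pigeonhole
-- principle at most that many of them are distinct.  Since N C k ≤ j and a
-- binomial coefficient of order k ≥ 3 eventually dominates any fixed multiple
-- of (N+1)², the count times the denominator of ε falls below j for large j,
-- which makes the ratio smaller than ε.
module Submission where

open import Defs

module Binomial where

  open import Data.Nat
  open import Data.Nat.Properties
  open import Data.Nat.Combinatorics using (_C_; nC1≡n; nCk+nC[k+1]≡[n+1]C[k+1])
  open import Data.Nat.Solver using (module +-*-Solver)
  open import Data.List using ([]; _∷_)
  open import Data.List.Relation.Unary.Linked using (Linked; _∷_)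
  open import Data.Product using (∃; _,_)
  open import Relation.Binary.PropositionalEquality
  open import Relation.Nullary using (yes; no)
  open +-*-Solver

  pascal : ∀ n k → suc n C suc k ≡ n C k + n C suc k
  pascal n k = sym (nCk+nC[k+1]≡[n+1]C[k+1] n k)

  C-step : ∀ n k → n C k ≤ suc n C k
  C-step n zero    = ≤-refl
  C-step n (suc k) = subst (n C suc k ≤_) (sym (pascal n k)) (m≤n+m _ _)

  C-monoˡ : ∀ {a b} k → a ≤ b → a C k ≤ b C k
  C-monoˡ {a} k a≤b with o , refl ← m≤n⇒∃[o]m+o≡n a≤b = go o
    where
    go : ∀ o → a C k ≤ (a + o) C k
    go zero    = ≤-reflexive (cong (_C k) (sym (+-identityʳ a)))
    go (suc o) = ≤-trans (go o) (subst (λ x → (a + o) C k ≤ x C k) (sym (+-suc a o)) (C-step (a + o) k))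

  C-shift : ∀ i n k → n C k ≤ (i + n) C (i + k)
  C-shift zero    n k = ≤-refl
  C-shift (suc i) n k = ≤-trans (C-shift i n k) diagonal
    where
    diagonal : (i + n) C (i + k) ≤ suc (i + n) C suc (i + k)
    diagonal = subst ((i + n) C (i + k) ≤_) (sym (pascal (i + n) (i + k))) (m≤m+n _ _)

  C-pos : ∀ {n k} → k ≤ n → 0 < n C k
  C-pos {n}     {zero}  _         = s≤s z≤n
  C-pos {suc n} {suc k} (s≤s k≤n) =
    subst (0 <_) (sym (pascal n k)) (<-≤-trans (C-pos k≤n) (m≤m+n _ _))

  -- A linear lower bound, used to bound the search for the largest a with
  -- a C (1+i) ≤ j.
  ≤-C-plus : ∀ a i → a ≤ a C suc i + i
  ≤-C-plus a i with i ≤? a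
  ... | yes i≤a = ≤-trans (≤-reflexive (sym (m∸n+n≡m i≤a))) (+-monoˡ-≤ i a∸i≤C)
    where
    a∸i≤C : a ∸ i ≤ a C suc i
    a∸i≤C = subst₂ _≤_ (nC1≡n (a ∸ i)) (cong₂ _C_ (m+[n∸m]≡n i≤a) (+-comm i 1)) (C-shift i (a ∸ i) 1)
  ... | no i≰a = ≤-trans (<⇒≤ (≰⇒> i≰a)) (m≤n+m i _)

  -- The tail [c, …] of a canonical representation is smaller than the next
  -- binomial coefficient (c+1) C l; this is what makes the representation
  -- unique, and here it bounds the part of m beyond the second term.
  canonical-tail< : ∀ l c t → Linked _>_ (c ∷ t) → Bounds l (c ∷ t) →
                    repSum l (c ∷ t) < suc c C l
  canonical-tail< (suc l) c t linked (l<c , _ , bounds) =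
    subst (repSum (suc l) (c ∷ t) <_) (sym (trans (pascal c l) (+-comm (c C l) (c C suc l))))
      (+-monoʳ-< (c C suc l) (rest t linked bounds))
    where
    rest : ∀ t → Linked _>_ (c ∷ t) → Bounds l t → repSum l t < c C l
    rest []       _            _      = C-pos (≤-trans (n≤1+n l) l<c)
    rest (d ∷ t′) (d<c ∷ lk′) bounds′ =
      <-≤-trans (canonical-tail< l d t′ lk′ bounds′) (C-monoˡ l d<c)

  C2-closed : ∀ t → 2 * (suc t C 2) ≡ suc t * t
  C2-closed zero    = refl
  C2-closed (suc t) = begin
    2 * (suc (suc t) C 2)        ≡⟨ cong (2 *_) (pascal (suc t) 1) ⟩
    2 * (suc t C 1 + suc t C 2)  ≡⟨ cong (λ x → 2 * (x + suc t C 2)) (nC1≡n (suc t)) ⟩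
    2 * (suc t + suc t C 2)      ≡⟨ *-distribˡ-+ 2 (suc t) (suc t C 2) ⟩
    2 * suc t + 2 * (suc t C 2)  ≡⟨ cong (2 * suc t +_) (C2-closed t) ⟩
    2 * suc t + suc t * t        ≡⟨ solve 1 (λ t → con 2 :* (con 1 :+ t) :+ (con 1 :+ t) :* t
                                                   := (con 2 :+ t) :* (con 1 :+ t)) refl t ⟩
    suc (suc t) * suc t          ∎
    where open ≡-Reasoning

  C3-closed : ∀ t → 6 * (suc (suc t) C 3) ≡ suc (suc t) * suc t * t
  C3-closed zero    = refl
  C3-closed (suc t) = begin
    6 * (suc (suc (suc t)) C 3)                    ≡⟨ cong (6 *_) (pascal (suc (suc t)) 2) ⟩
    6 * (suc (suc t) C 2 + suc (suc t) C 3)        ≡⟨ *-distribˡ-+ 6 (suc (suc t) C 2) _ ⟩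
    6 * (suc (suc t) C 2) + 6 * (suc (suc t) C 3)  ≡⟨ cong₂ _+_ (trans (*-assoc 3 2 (suc (suc t) C 2)) (cong (3 *_) (C2-closed (suc t)))) (C3-closed t) ⟩
    3 * (suc (suc t) * suc t) + suc (suc t) * suc t * t
      ≡⟨ solve 1 (λ t → con 3 :* ((con 2 :+ t) :* (con 1 :+ t)) :+ (con 2 :+ t) :* (con 1 :+ t) :* t
                        := (con 3 :+ t) :* (con 2 :+ t) :* (con 1 :+ t)) refl t ⟩
    suc (suc (suc t)) * suc (suc t) * suc t        ∎
    where open ≡-Reasoning

  cube≤6*C3 : ∀ t → t * (t * t) ≤ 6 * (suc (suc t) C 3)
  cube≤6*C3 t = begin
    t * (t * t)                ≤⟨ *-mono-≤ (n≤1+n t) (*-monoˡ-≤ t (≤-trans (n≤1+n t) (n≤1+n (suc t)))) ⟩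
    suc t * (suc (suc t) * t)  ≡⟨ solve 1 (λ t → (con 1 :+ t) :* ((con 2 :+ t) :* t)
                                                 := (con 2 :+ t) :* (con 1 :+ t) :* t) refl t ⟩
    suc (suc t) * suc t * t    ≡⟨ sym (C3-closed t) ⟩
    6 * (suc (suc t) C 3)      ∎
    where open ≤-Reasoning

  -- The quantitative heart: once t > 6K(i+4)², the square K·(t+i+3)² lies
  -- below (i+t+2) C (i+3), because the latter is at least (t+2) C 3 ≥ t³/6.
  square<C : ∀ i K t → 6 * K * ((i + 4) * (i + 4)) < t →
             K * ((t + (i + 3)) * (t + (i + 3))) < (i + suc (suc t)) C (i + 3)
  square<C i K t large = *-cancelˡ-< 6 _ _ (begin-strict
    6 * (K * (X * X))                      ≤⟨ *-monoʳ-≤ 6 (*-monoʳ-≤ K (*-mono-≤ X≤ X≤)) ⟩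
    6 * (K * ((i + 4) * t * ((i + 4) * t)))
      ≡⟨ solve 4 (λ K a t b → con 6 :* (K :* (a :* t :* (b :* t)))
                              := con 6 :* K :* (a :* b) :* (t :* t)) refl K (i + 4) t (i + 4) ⟩
    6 * K * ((i + 4) * (i + 4)) * (t * t)  <⟨ *-monoˡ-< (t * t) {{t*t≢0}} large ⟩
    t * (t * t)                            ≤⟨ cube≤6*C3 t ⟩
    6 * (suc (suc t) C 3)                  ≤⟨ *-monoʳ-≤ 6 (C-shift i (suc (suc t)) 3) ⟩
    6 * ((i + suc (suc t)) C (i + 3))      ∎)
    where
    open ≤-Reasoning
    X = t + (i + 3)
    1≤t : 1 ≤ t
    1≤t = ≤-trans (s≤s z≤n) large
    X≤ : X ≤ (i + 4) * t
    X≤ = begin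
      t + (i + 3)      ≤⟨ +-monoʳ-≤ t (≤-trans (≤-reflexive (sym (*-identityʳ (i + 3)))) (*-monoʳ-≤ (i + 3) 1≤t)) ⟩
      t + (i + 3) * t  ≡⟨ solve 2 (λ t i → t :+ (i :+ con 3) :* t := (i :+ con 4) :* t) refl t i ⟩
      (i + 4) * t      ∎
    t*t≢0 : NonZero (t * t)
    t*t≢0 = >-nonZero (*-mono-< 1≤t 1≤t)

  -- Consequently, for every K some bound J exceeds K·(N+1)² whenever
  -- N C (3+i) ≤ j and J ≤ j: for small N by the choice of J, for large N by
  -- square<C.
  square<-eventually : ∀ K i → ∃ λ J → ∀ j N → J ≤ j → N C (3 + i) ≤ j →
                       K * (suc N * suc N) < j
  square<-eventually K i = suc (K * (A * A)) , below
    where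
    T = suc (6 * K * ((i + 4) * (i + 4)))
    A = i + suc (suc T)
    below : ∀ j N → suc (K * (A * A)) ≤ j → N C (3 + i) ≤ j → K * (suc N * suc N) < j
    below j N J≤j NCk≤j with N <? A
    ... | yes N<A = <-≤-trans (s≤s (*-monoʳ-≤ K (*-mono-≤ N<A N<A))) J≤j
    ... | no N≮A with e , refl ← m≤n⇒∃[o]m+o≡n (≮⇒≥ N≮A) =
      <-≤-trans (subst₂ (λ x y → K * x < y C (i + 3)) square-eq index-eq
                  (square<C i K (T + e) (<-≤-trans (n<1+n _) (m≤m+n T e))))
                (subst (λ z → (A + e) C z ≤ j) (+-comm 3 i) NCk≤j)
      where
      square-eq : (T + e + (i + 3)) * (T + e + (i + 3)) ≡ suc (A + e) * suc (A + e)
      square-eq = solve 3 (λ T e i → (T :+ e :+ (i :+ con 3)) :* (T :+ e :+ (i :+ con 3))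
                  := (con 1 :+ ((i :+ (con 2 :+ T)) :+ e)) :* (con 1 :+ ((i :+ (con 2 :+ T)) :+ e))) refl T e i
      index-eq : i + suc (suc (T + e)) ≡ A + e
      index-eq = solve 3 (λ T e i → i :+ (con 2 :+ (T :+ e)) := (i :+ (con 2 :+ T)) :+ e) refl T e i

module Counting where

  open import Data.Nat using (ℕ; zero; suc; _+_; _*_; _≤_; _<_; z≤n; s≤s; s≤s⁻¹)
  open import Data.Nat.Properties using (_≟_; ≤-trans; ≤∧≢⇒<)
  open import Data.List using (List; []; _∷_; _++_; length; filter; applyUpTo)
  open import Data.List.Properties using (length-++; length-applyUpTo; filter-notAll)
  open import Data.List.Membership.Propositional using (_∈_)
  open import Data.List.Membership.Propositional.Properties
    using (∈-++⁺ˡ; ∈-++⁺ʳ; ∈-applyUpTo⁺; ∈-filter⁺)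
  open import Data.List.Relation.Unary.Any as Any using ()
  open import Data.List.Relation.Unary.All using (All; []; _∷_)
  open import Data.List.Relation.Unary.Unique.Propositional using (Unique)
  open import Data.List.Relation.Unary.AllPairs using (_∷_)
  open import Relation.Binary.PropositionalEquality
  open import Relation.Nullary using (yes; no; ¬?)

  -- Pigeonhole: a list of distinct elements, all of which occur in C, is
  -- no longer than C.  Each element is deleted from C in turn.
  pigeonhole : ∀ (L C : List ℕ) → Unique L → All (_∈ C) L → length L ≤ length C
  pigeonhole []       C _                _               = z≤n
  pigeonhole (x ∷ xs) C (x∉xs ∷ unique) (x∈C ∷ xs⊆C) =
    ≤-trans (s≤s (pigeonhole xs C′ unique (inC′ x∉xs xs⊆C)))
            (filter-notAll (λ y → ¬? (x ≟ y)) C (Any.map (λ x≡y x≢y → x≢y x≡y) x∈C))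
    where
    C′ = filter (λ y → ¬? (x ≟ y)) C
    inC′ : ∀ {ys} → All (x ≢_) ys → All (_∈ C) ys → All (_∈ C′) ys
    inC′ []           []             = []
    inC′ (x≢y ∷ x≢ys) (y∈C ∷ ys⊆C) = ∈-filter⁺ (λ y → ¬? (x ≟ y)) y∈C x≢y ∷ inC′ x≢ys ys⊆C

  concatUpTo : (ℕ → List ℕ) → ℕ → List ℕ
  concatUpTo g zero    = []
  concatUpTo g (suc n) = g n ++ concatUpTo g n

  length-concatUpTo : ∀ g c → (∀ a → length (g a) ≡ c) → ∀ n → length (concatUpTo g n) ≡ n * c
  length-concatUpTo g c len zero    = refl
  length-concatUpTo g c len (suc n) =
    trans (length-++ (g n)) (cong₂ _+_ (len n) (length-concatUpTo g c len n))

  ∈-concatUpTo : ∀ g {x a} n → a < n → x ∈ g a → x ∈ concatUpTo g n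
  ∈-concatUpTo g {a = a} (suc n) a<1+n x∈ga with a ≟ n
  ... | yes refl = ∈-++⁺ˡ x∈ga
  ... | no a≢n   = ∈-++⁺ʳ (g n) (∈-concatUpTo g n (≤∧≢⇒< (s≤s⁻¹ a<1+n) a≢n) x∈ga)

  image3 : (ℕ → ℕ → ℕ → ℕ) → ℕ → ℕ → ℕ → List ℕ
  image3 f n₁ n₂ n₃ = concatUpTo (λ a → concatUpTo (λ b → applyUpTo (f a b) n₃) n₂) n₁

  length-image3 : ∀ f n₁ n₂ n₃ → length (image3 f n₁ n₂ n₃) ≡ n₁ * (n₂ * n₃)
  length-image3 f n₁ n₂ n₃ =
    length-concatUpTo _ _ (λ a → length-concatUpTo _ _ (λ b → length-applyUpTo (f a b) n₃) n₂) n₁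

  ∈-image3 : ∀ f n₁ n₂ n₃ {a b r} → a < n₁ → b < n₂ → r < n₃ → f a b r ∈ image3 f n₁ n₂ n₃
  ∈-image3 f n₁ n₂ n₃ a< b< r< =
    ∈-concatUpTo _ n₁ a< (∈-concatUpTo _ n₂ b< (∈-applyUpTo⁺ (f _ _) r<))

module Search where

  open import Data.Nat using (ℕ; zero; suc; _≤_; s≤s⁻¹)
  open import Data.Nat.Properties using (_≟_; ≤∧≢⇒<)
  open import Data.Product using (Σ; _×_; _,_)
  open import Relation.Nullary using (Dec; yes; no; contradiction)
  open import Relation.Binary.PropositionalEquality using (refl)

  greatest : (P : ℕ → Set) → (∀ a → Dec (P a)) → P 0 →
             ∀ u → (∀ a → P a → a ≤ u) → Σ ℕ λ N → P N × (∀ a → P a → a ≤ N)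
  greatest P P? P0 zero    bounded = 0 , P0 , bounded
  greatest P P? P0 (suc u) bounded with P? (suc u)
  ... | yes Pu = suc u , Pu , bounded
  ... | no ¬Pu = greatest P P? P0 u below-u
    where
    below-u : ∀ a → P a → a ≤ u
    below-u a Pa with a ≟ suc u
    ... | yes refl = contradiction Pa ¬Pu
    ... | no a≢u   = s≤s⁻¹ (≤∧≢⇒< (bounded a Pa) a≢u)

module Ratio where

  open import Data.Nat as ℕ using (ℕ; zero)
  open import Data.Integer as ℤ using (+_; +[1+_]; 1ℤ)
  import Data.Integer.Properties as ℤ
  open import Data.Integer.GCD using (gcd)
  open import Data.Rational using (ℚ; 0ℚ; _/_; _<_; *<*; ↥_; ↧_; ↧ₙ_)
  open import Data.Rational.Properties using (↥-/; ↧-/)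
  open import Relation.Binary.PropositionalEquality

  -- For ε > 0 with denominator D, n·D < j forces n/j < ε (as ε ≥ 1/D).
  ratio< : ∀ n j .{{_ : ℕ.NonZero j}} (ε : ℚ) → 0ℚ < ε → n ℕ.* ↧ₙ ε ℕ.< j → (+ n) / j < ε
  ratio< n j ε (*<* 0<ε) nD<j = *<* (ℤ.*-cancelʳ-<-nonNeg g scaled)
    where
    p = (+ n) / j
    g = gcd (+ n) (+ j)
    1≤↥ε : 1ℤ ℤ.≤ ↥ ε
    1≤↥ε with ↥ ε | subst₂ ℤ._<_ (ℤ.*-zeroˡ (↧ ε)) (ℤ.*-identityʳ (↥ ε)) 0<ε
    ... | +[1+ _ ] | _ = ℤ.+≤+ (ℕ.s≤s ℕ.z≤n)
    ... | + zero   | ℤ.+<+ ()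
    lhs : (↥ p ℤ.* ↧ ε) ℤ.* g ≡ + (n ℕ.* ↧ₙ ε)
    lhs = begin
      (↥ p ℤ.* ↧ ε) ℤ.* g  ≡⟨ ℤ.*-assoc (↥ p) (↧ ε) g ⟩
      ↥ p ℤ.* (↧ ε ℤ.* g)  ≡⟨ cong (↥ p ℤ.*_) (ℤ.*-comm (↧ ε) g) ⟩
      ↥ p ℤ.* (g ℤ.* ↧ ε)  ≡⟨ sym (ℤ.*-assoc (↥ p) g (↧ ε)) ⟩
      (↥ p ℤ.* g) ℤ.* ↧ ε  ≡⟨ cong (ℤ._* ↧ ε) (↥-/ (+ n) j) ⟩
      + n ℤ.* + (↧ₙ ε)     ≡⟨ sym (ℤ.pos-* n (↧ₙ ε)) ⟩
      + (n ℕ.* ↧ₙ ε)       ∎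
      where open ≡-Reasoning
    rhs : (↥ ε ℤ.* ↧ p) ℤ.* g ≡ ↥ ε ℤ.* + j
    rhs = trans (ℤ.*-assoc (↥ ε) (↧ p) g) (cong (↥ ε ℤ.*_) (↧-/ (+ n) j))
    j≤↥ε*j : + j ℤ.≤ ↥ ε ℤ.* + j
    j≤↥ε*j = subst (ℤ._≤ ↥ ε ℤ.* + j) (ℤ.*-identityˡ (+ j)) (ℤ.*-monoʳ-≤-nonNeg (+ j) 1≤↥ε)
    scaled : (↥ p ℤ.* ↧ ε) ℤ.* g ℤ.< (↥ ε ℤ.* ↧ p) ℤ.* g
    scaled = subst₂ ℤ._<_ (sym lhs) (sym rhs) (ℤ.<-≤-trans (ℤ.+<+ nD<j) j≤↥ε*j)

open import Data.Nat using (ℕ; _≤_; NonZero)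
open import Data.Integer using (ℤ; +_)
open import Data.Rational using (ℚ; 0ℚ; _/_; _<_; ↧ₙ_)
open import Data.List using (List; length; []; _∷_)
open import Data.Product using (∃; ∃₂; _×_; _,_; proj₁; proj₂)

open Binomial using (C-monoˡ; ≤-C-plus; canonical-tail<; square<-eventually)
open Counting using (pigeonhole; image3; length-image3; ∈-image3)
open Search using (greatest)
open Ratio using (ratio<)
open import Data.Nat as ℕ using (suc; _+_; _*_; z≤n; s≤s; _≤?_)
open import Data.Nat.Properties using (≤-trans; <-≤-trans; <⇒≤; ≤-reflexive; m≤m+n; +-monoˡ-≤; *-monoˡ-≤; module ≤-Reasoning)
open import Data.Nat.Combinatorics using (_C_)
open import Data.Nat.Solver using (module +-*-Solver)
open import Data.Integer as ℤ using (∣_∣; -[1+_])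
open import Data.List.Membership.Propositional using (_∈_)
open import Data.List.Relation.Unary.All as All using (All)
open import Data.List.Relation.Unary.Linked using (_∷_)
open import Relation.Binary.PropositionalEquality using (_≡_; refl; sym)

third<∣w∣ : ∀ c w → + c ℤ.< w → c ℕ.< ∣ w ∣
third<∣w∣ c (+ n)    (ℤ.+<+ c<n) = c<n
third<∣w∣ c -[1+ n ] ()

-- a C k + b C (k-1) + r, for k = 3 + i: the first two terms of a
-- k-representation followed by the value r of the remaining terms.
twoTermsPlus : ℕ → ℕ → ℕ → ℕ → ℕ
twoTermsPlus i a b r = a C (3 + i) + (b C (2 + i) + r)

small-third-shape : ∀ i w m → SmallThird (3 + i) w m →
  ∃₂ λ a b → ∃ λ r → m ≡ twoTermsPlus i a b r × b ℕ.≤ a × r ℕ.≤ ∣ w ∣ C (1 + i)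
small-third-shape i w m ([] , (() , _) , _)
small-third-shape i w m ((a ∷ []) , (_ , _ , _ , eq) , _) =
  a , 0 , 0 , sym eq , z≤n , z≤n
small-third-shape i w m ((a ∷ b ∷ []) , (_ , (b<a ∷ _) , _ , eq) , _) =
  a , b , 0 , sym eq , <⇒≤ b<a , z≤n
small-third-shape i w m ((a ∷ b ∷ c ∷ t) , (_ , (b<a ∷ _ ∷ linked) , (_ , _ , _ , _ , bounds) , eq) , c<w) =
  a , b , _ , sym eq , <⇒≤ b<a ,
  <⇒≤ (<-≤-trans (canonical-tail< (suc i) c t linked bounds) (C-monoˡ (suc i) (third<∣w∣ c w c<w)))

small-thirds-are-candidates : ∀ i w j N → (∀ a → a C (3 + i) ℕ.≤ j → a ℕ.≤ N) →
  ∀ m → m ℕ.≤ j → SmallThird (3 + i) w m →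
  m ∈ image3 (twoTermsPlus i) (suc N) (suc N) (suc (∣ w ∣ C (1 + i)))
small-thirds-are-candidates i w j N maximal m m≤j small
  with a , b , r , refl , b≤a , r≤ ← small-third-shape i w m small =
  ∈-image3 (twoTermsPlus i) _ _ _ (s≤s a≤N) (s≤s (≤-trans b≤a a≤N)) (s≤s r≤)
  where
  a≤N : a ℕ.≤ N
  a≤N = maximal a (≤-trans (m≤m+n _ _) m≤j)

few-small-thirds : ∀ i w j N → (∀ a → a C (3 + i) ℕ.≤ j → a ℕ.≤ N) →
  ∀ L → DistinctIn (SmallThird (3 + i) w) j L →
  length L ℕ.≤ suc N * (suc N * suc (∣ w ∣ C (1 + i)))
few-small-thirds i w j N maximal L (distinct , inRange) =
  ≤-trans (pigeonhole L _ distinct candidates) 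
          (≤-reflexive (length-image3 (twoTermsPlus i) (suc N) (suc N) (suc (∣ w ∣ C (1 + i)))))
  where
  candidates : All (_∈ image3 (twoTermsPlus i) (suc N) (suc N) (suc (∣ w ∣ C (1 + i)))) L
  candidates = All.map (λ (_ , m≤j , small) →
    small-thirds-are-candidates i w j N maximal _ m≤j small) inRange

-- The largest N with N C k ≤ j; it exists since 0 C k = 0 and a ≤ a C k + (k-1).
largest-below : ∀ i j → ∃ λ N → N C (3 + i) ℕ.≤ j × (∀ a → a C (3 + i) ℕ.≤ j → a ℕ.≤ N)
largest-below i j =
  greatest (λ a → a C (3 + i) ℕ.≤ j) (λ a → a C (3 + i) ≤? j) z≤n (j + suc (suc i))
    (λ a aCk≤j → ≤-trans (≤-C-plus a (suc (suc i))) (+-monoˡ-≤ (suc (suc i)) aCk≤j))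

lemma4p5 : (k : ℕ) → 3 ≤ k → (w : ℤ) →
    (ε : ℚ) → 0ℚ < ε →
    ∃ λ J → (j : ℕ) → J ≤ j → .{{_ : NonZero j}} →
      (L : List ℕ) → DistinctIn (SmallThird k w) j L →
      (+ length L) / j < ε
lemma4p5 (suc (suc (suc i))) (s≤s (s≤s (s≤s z≤n))) w ε 0<ε = J , bound
  where
  B = suc (∣ w ∣ C suc i)
  D = ↧ₙ ε
  K = B * D
  J = proj₁ (square<-eventually K i)
  bound : (j : ℕ) → J ≤ j → .{{_ : NonZero j}} →
          (L : List ℕ) → DistinctIn (SmallThird (3 + i) w) j L → (+ length L) / j < ε
  bound j J≤j L distinctIn with N , NCk≤j , maximal ← largest-below i j =
    ratio< (length L) j ε 0<ε (begin-strict
      length L * D             ≤⟨ *-monoˡ-≤ D (few-small-thirds i w j N maximal L distinctIn) ⟩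
      suc N * (suc N * B) * D  ≡⟨ solve 3 (λ n b d → n :* (n :* b) :* d := b :* d :* (n :* n)) refl (suc N) B D ⟩
      K * (suc N * suc N)      <⟨ proj₂ (square<-eventually K i) j N J≤j NCk≤j ⟩
      j                        ∎)
    where
    open ≤-Reasoning
    open +-*-Solver
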